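{- Let $q$ be an odd prime, let $r$ be an integer, and let $c_1,\dots,c_{q-1}$ be integers. Let $\sigma(n)$ be the sum of positive divisors of $n$ and $\sigma_{even}(n)$ the sum of the even positive divisors of $n$ (both set to $0$ for $n\le 0$). For $k\ge 1$ let $\sigma^{*k}$ and $\sigma_{even}^{*k}$ denote $k$-fold self-convolutions, e.g. $\sigma^{*k}(n)=\sum_{a_1+\dots+a_k=n,\ a_i\ge 0}\sigma(a_1)\cdots\sigma(a_k)$ (and $0$ for $n<0$). Then the statements \[ \sum_{k=1}^{q-1}c_k\sigma^{*k}(qn+r)\equiv 0\pmod q\quad\text{for all }n\in\mathbb{Z} \] and \[ \sum_{k=1}^{q-1}\Big(\frac{q+1}{2}\Big)^k c_k\,\sigma_{even}^{*k}(qn+2r)\equiv 0\pmod q\quad\text{for all }n\in\mathbb{Z} \] are equivalent. -}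

module Defs where

open import Data.Nat as ℕ using (ℕ; zero; suc)
open import Data.Nat.Divisibility using (_∣?_)
open import Data.Integer as ℤ using (ℤ; +_; -[1+_]; _+_; _*_)
open import Data.List using (List; []; _∷_; upTo; map; filter; foldr)
open import Data.Fin using (Fin; toℕ)
open import Relation.Nullary.Decidable using (does)
open import Data.Bool using (if_then_else_; _∧_)

sumℤ : List ℤ → ℤ
sumℤ = foldr _+_ (+ 0)

-- σ(m) for m : ℕ : sum of positive divisors d of m (σ(0) = 0, since the range 1..m is empty)
σℕ : ℕ → ℤ
σℕ m = sumℤ (map (λ d → if does (d ∣? m) then + d else + 0) (map suc (upTo m)))

σevenℕ : ℕ → ℤ
σevenℕ m = sumℤ (map (λ d → if does (d ∣? m) ∧ does (2 ∣? d) then + d else + 0)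
                     (map suc (upTo m)))

σ : ℤ → ℤ
σ (+ m)     = σℕ m
σ -[1+ _ ]  = + 0

σeven : ℤ → ℤ
σeven (+ m)    = σevenℕ m
σeven -[1+ _ ] = + 0

-- (k+1)-fold self-convolution of f : ℕ → ℤ at m ≥ 0:
-- f^{*(k+1)}(m) = Σ_{a_1+…+a_{k+1}=m, a_i ≥ 0} f(a_1)⋯f(a_{k+1})
convSuc : ℕ → (ℕ → ℤ) → ℕ → ℤ
convSuc zero    f m = f m
convSuc (suc k) f m = sumℤ (map (λ a → f a * convSuc k f (m ℕ.∸ a)) (upTo (suc m)))

-- k-fold self-convolution on ℤ (k ≥ 1), 0 at negative arguments; at k = 0 returns 0 (never used)
conv : ℕ → (ℕ → ℤ) → ℤ → ℤ
conv zero    f n        = + 0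
conv (suc k) f (+ m)    = convSuc k f m
conv (suc k) f -[1+ _ ] = + 0

sumFrom1 : ℕ → (ℕ → ℤ) → ℤ
sumFrom1 N g = sumℤ (map (λ i → g (suc i)) (upTo N))

-- An even divisor of m is 2d with d a divisor of m/2, so σ_even vanishes at odd
-- arguments and σ_even(2t) = 2σ(t). Convolution preserves both properties:
-- σ_even^{*k} vanishes at odd arguments and σ_even^{*k}(2t) = 2^k σ^{*k}(t).
-- As h = (q+1)/2 inverts 2 modulo q, the twisted σ_even-sum at 2x is congruent to
-- the σ-sum at x. For odd n the argument qn + 2r is odd and the second sum is 0;
-- for n = 2m it is 2(qm + r), and the two conditions coincide.
module Submission where

open import Defs
open import Data.Nat as ℕ using (ℕ; suc; zero; _∸_; _/_; z≤n; s≤s)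
open import Data.Nat.Primality using (Prime)
open import Data.Integer as ℤ using (ℤ; +_; -[1+_]; 0ℤ; 1ℤ; _+_; _*_; _-_; _^_)
open import Data.Integer.Divisibility using (_∣_)
open import Data.Product using (_,_; ∃; proj₁; proj₂)
open import Data.Sum using (_⊎_; inj₁; inj₂)
open import Data.Bool using (true; false; if_then_else_; _∧_)
open import Data.Bool.Properties using (∧-identityʳ; ∧-zeroʳ)
open import Data.List using (map; upTo; applyUpTo)
open import Data.List.Properties using (map-upTo; map-applyUpTo)
open import Function using (_∘_)
open import Function.Bundles using (_⇔_; mk⇔; module Equivalence)
open import Relation.Nullary using (¬_; does; contradiction)
open import Relation.Nullary.Decidable using (toSum; dec-true; dec-false; does-⇔)
open import Relation.Binary.PropositionalEquality
open import Data.Nat.Divisibility as ℕ∣ using (_∣?_; divides; ∣-trans) renaming (_∣_ to _ℕ∣_)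
import Data.Nat.Properties as ℕ
import Data.Nat.DivMod as ℕ/
import Data.Integer.Properties as ℤ
import Data.Integer.DivMod as ℤ/
open import Data.Integer.Divisibility.Signed
  using (∣ᵤ⇒∣; ∣⇒∣ᵤ; ∣m+n∣n⇒∣m; ∣m∣n⇒∣m+n; ∣m⇒∣m*n) renaming (_∣_ to _∣ₛ_; ∣-refl to ∣ₛ-refl)
open import Data.Integer.Tactic.RingSolver using (solve-∀)

open ≡-Reasoning

∑< : ℕ → (ℕ → ℤ) → ℤ
∑< n f = sumℤ (applyUpTo f n)

syntax ∑< n (λ i → e) = ∑[ i < n ] e

sumℤ-map-upTo : ∀ f n → sumℤ (map f (upTo n)) ≡ ∑< n f
sumℤ-map-upTo f n = cong sumℤ (map-upTo f n)

∑<-cong : ∀ n {f g : ℕ → ℤ} → (∀ {i} → i ℕ.< n → f i ≡ g i) → ∑< n f ≡ ∑< n g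
∑<-cong zero    f≗g = refl
∑<-cong (suc n) f≗g = cong₂ _+_ (f≗g (s≤s z≤n)) (∑<-cong n (f≗g ∘ s≤s))

∑<-zero : ∀ n {f : ℕ → ℤ} → (∀ {i} → i ℕ.< n → f i ≡ 0ℤ) → ∑< n f ≡ 0ℤ
∑<-zero zero    f≗0 = refl
∑<-zero (suc n) f≗0 = cong₂ _+_ (f≗0 (s≤s z≤n)) (∑<-zero n (f≗0 ∘ s≤s))

∑<-distrib-+ : ∀ n (f g : ℕ → ℤ) → ∑[ i < n ] (f i + g i) ≡ ∑< n f + ∑< n g
∑<-distrib-+ zero    f g = refl
∑<-distrib-+ (suc n) f g = begin
  (f 0 + g 0) + ∑[ i < n ] (f (suc i) + g (suc i))   ≡⟨ cong (λ s → (f 0 + g 0) + s) (∑<-distrib-+ n (f ∘ suc) (g ∘ suc)) ⟩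
  (f 0 + g 0) + (∑< n (f ∘ suc) + ∑< n (g ∘ suc))   ≡⟨ interchange (f 0) (g 0) _ _ ⟩
  (f 0 + ∑< n (f ∘ suc)) + (g 0 + ∑< n (g ∘ suc))   ∎
  where
  interchange : ∀ a b c d → (a + b) + (c + d) ≡ (a + c) + (b + d)
  interchange = solve-∀

*-distribˡ-∑< : ∀ n k (f : ℕ → ℤ) → ∑[ i < n ] (k * f i) ≡ k * ∑< n f
*-distribˡ-∑< zero    k f = sym (ℤ.*-zeroʳ k)
*-distribˡ-∑< (suc n) k f = begin
  k * f 0 + ∑[ i < n ] (k * f (suc i))   ≡⟨ cong (λ s → k * f 0 + s) (*-distribˡ-∑< n k (f ∘ suc)) ⟩
  k * f 0 + k * ∑< n (f ∘ suc)          ≡⟨ ℤ.*-distribˡ-+ k (f 0) _ ⟨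
  k * (f 0 + ∑< n (f ∘ suc))            ∎

∑<-even-odd : ∀ n (f : ℕ → ℤ) → ∑< (2 ℕ.* n) f ≡ ∑[ i < n ] f (2 ℕ.* i) + ∑[ i < n ] f (suc (2 ℕ.* i))
∑<-even-odd zero    f = refl
∑<-even-odd (suc n) f = begin
  ∑< (2 ℕ.* suc n) f
    ≡⟨ cong (λ m → ∑< m f) (ℕ.*-suc 2 n) ⟩
  f 0 + (f 1 + ∑< (2 ℕ.* n) (f ∘ suc ∘ suc))
    ≡⟨ cong (λ s → f 0 + (f 1 + s)) (∑<-even-odd n (f ∘ suc ∘ suc)) ⟩
  f 0 + (f 1 + (∑[ i < n ] f (2 ℕ.+ 2 ℕ.* i) + ∑[ i < n ] f (3 ℕ.+ 2 ℕ.* i)))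
    ≡⟨ shuffle (f 0) (f 1) _ _ ⟩
  (f 0 + ∑[ i < n ] f (2 ℕ.+ 2 ℕ.* i)) + (f 1 + ∑[ i < n ] f (3 ℕ.+ 2 ℕ.* i))
    ≡⟨ cong₂ (λ s t → (f 0 + s) + (f 1 + t))
         (∑<-cong n λ {i} _ → cong f (sym (ℕ.*-suc 2 i)))
         (∑<-cong n λ {i} _ → cong (f ∘ suc) (sym (ℕ.*-suc 2 i))) ⟩
  ∑[ i < suc n ] f (2 ℕ.* i) + ∑[ i < suc n ] f (suc (2 ℕ.* i))
    ∎
  where
  shuffle : ∀ a b c d → a + (b + (c + d)) ≡ (a + c) + (b + d)
  shuffle = solve-∀

∑<-suc-even-odd : ∀ n (f : ℕ → ℤ) →
  ∑< (suc (2 ℕ.* n)) f ≡ ∑[ i < suc n ] f (2 ℕ.* i) + ∑[ i < n ] f (suc (2 ℕ.* i))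
∑<-suc-even-odd n f = begin
  f 0 + ∑< (2 ℕ.* n) (f ∘ suc)
    ≡⟨ cong (λ s → f 0 + s) (∑<-even-odd n (f ∘ suc)) ⟩
  f 0 + (∑[ i < n ] f (suc (2 ℕ.* i)) + ∑[ i < n ] f (2 ℕ.+ 2 ℕ.* i))
    ≡⟨ shuffle (f 0) _ _ ⟩
  (f 0 + ∑[ i < n ] f (2 ℕ.+ 2 ℕ.* i)) + ∑[ i < n ] f (suc (2 ℕ.* i))
    ≡⟨ cong (λ s → (f 0 + s) + ∑[ i < n ] f (suc (2 ℕ.* i))) (∑<-cong n λ {i} _ → cong f (sym (ℕ.*-suc 2 i))) ⟩
  ∑[ i < suc n ] f (2 ℕ.* i) + ∑[ i < n ] f (suc (2 ℕ.* i))
    ∎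
  where
  shuffle : ∀ a b c → a + (b + c) ≡ (a + c) + b
  shuffle = solve-∀

divisorTerm evenDivisorTerm : ℕ → ℕ → ℤ
divisorTerm     m d = if does (d ∣? m) then + d else 0ℤ
evenDivisorTerm m d = if does (d ∣? m) ∧ does (2 ∣? d) then + d else 0ℤ

σℕ-as-∑< : ∀ m → σℕ m ≡ ∑[ i < m ] divisorTerm m (suc i)
σℕ-as-∑< m = cong sumℤ (trans (cong (map (divisorTerm m)) (map-upTo suc m)) (map-applyUpTo suc (divisorTerm m) m))

σevenℕ-as-∑< : ∀ m → σevenℕ m ≡ ∑[ i < m ] evenDivisorTerm m (suc i)
σevenℕ-as-∑< m = cong sumℤ (trans (cong (map (evenDivisorTerm m)) (map-upTo suc m)) (map-applyUpTo suc (evenDivisorTerm m) m))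

2∤1+2*n : ∀ n → ¬ 2 ℕ∣ suc (2 ℕ.* n)
2∤1+2*n n (divides k eq) = ℕ.even≢odd k n (sym (trans eq (ℕ.*-comm k 2)))

evenDivisorTerm-odd-divisor : ∀ m {d} → ¬ 2 ℕ∣ d → evenDivisorTerm m d ≡ 0ℤ
evenDivisorTerm-odd-divisor m {d} 2∤d rewrite dec-false (2 ∣? d) 2∤d | ∧-zeroʳ (does (d ∣? m)) = refl

evenDivisorTerm-non-divisor : ∀ {m d} → ¬ d ℕ∣ m → evenDivisorTerm m d ≡ 0ℤ
evenDivisorTerm-non-divisor {m} {d} d∤m rewrite dec-false (d ∣? m) d∤m = refl

evenDivisorTerm-odd : ∀ {m} → ¬ 2 ℕ∣ m → ∀ d → evenDivisorTerm m d ≡ 0ℤ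
evenDivisorTerm-odd {m} 2∤m d with toSum (d ∣? m)
... | inj₁ d∣m = evenDivisorTerm-odd-divisor m (λ 2∣d → 2∤m (∣-trans 2∣d d∣m))
... | inj₂ d∤m = evenDivisorTerm-non-divisor d∤m

evenDivisorTerm-double : ∀ t d → evenDivisorTerm (2 ℕ.* t) (2 ℕ.* d) ≡ + 2 * divisorTerm t d
evenDivisorTerm-double t d
  rewrite dec-true (2 ∣? 2 ℕ.* d) (ℕ∣.m∣m*n d)
        | ∧-identityʳ (does (2 ℕ.* d ∣? 2 ℕ.* t))
        | does-⇔ (mk⇔ (ℕ∣.*-cancelˡ-∣ 2) (ℕ∣.*-monoʳ-∣ 2)) (2 ℕ.* d ∣? 2 ℕ.* t) (d ∣? t)
  with does (d ∣? t)
... | true  = ℤ.pos-* 2 d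
... | false = refl

σevenℕ-odd : ∀ {m} → ¬ 2 ℕ∣ m → σevenℕ m ≡ 0ℤ
σevenℕ-odd {m} 2∤m = trans (σevenℕ-as-∑< m) (∑<-zero m λ {i} _ → evenDivisorTerm-odd 2∤m (suc i))

σevenℕ-double : ∀ t → σevenℕ (2 ℕ.* t) ≡ + 2 * σℕ t
σevenℕ-double t = begin
  σevenℕ (2 ℕ.* t)
    ≡⟨ σevenℕ-as-∑< (2 ℕ.* t) ⟩
  ∑[ i < 2 ℕ.* t ] E (suc i)
    ≡⟨ ∑<-even-odd t (E ∘ suc) ⟩
  ∑[ i < t ] E (suc (2 ℕ.* i)) + ∑[ i < t ] E (2 ℕ.+ 2 ℕ.* i)
    ≡⟨ cong₂ _+_ (∑<-zero t λ {i} _ → evenDivisorTerm-odd-divisor (2 ℕ.* t) (2∤1+2*n i))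
                 (∑<-cong t λ {i} _ → trans (cong E (sym (ℕ.*-suc 2 i))) (evenDivisorTerm-double t (suc i))) ⟩
  0ℤ + ∑[ i < t ] (+ 2 * divisorTerm t (suc i))
    ≡⟨ ℤ.+-identityˡ _ ⟩
  ∑[ i < t ] (+ 2 * divisorTerm t (suc i))
    ≡⟨ *-distribˡ-∑< t (+ 2) _ ⟩
  + 2 * ∑[ i < t ] divisorTerm t (suc i)
    ≡⟨ cong (+ 2 *_) (σℕ-as-∑< t) ⟨
  + 2 * σℕ t
    ∎
  where
  E : ℕ → ℤ
  E = evenDivisorTerm (2 ℕ.* t)

2*m∸2*n≡2*[m∸n] : ∀ m n → 2 ℕ.* m ∸ 2 ℕ.* n ≡ 2 ℕ.* (m ∸ n)
2*m∸2*n≡2*[m∸n] m n = sym (ℕ.*-distribˡ-∸ 2 m n)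

1+2*m∸2*n≡1+2*[m∸n] : ∀ {m n} → n ℕ.≤ m → suc (2 ℕ.* m) ∸ 2 ℕ.* n ≡ suc (2 ℕ.* (m ∸ n))
1+2*m∸2*n≡1+2*[m∸n] {m} {n} n≤m =
  trans (ℕ.+-∸-assoc 1 (ℕ.*-monoʳ-≤ 2 n≤m)) (cong suc (2*m∸2*n≡2*[m∸n] m n))

module _ {f g : ℕ → ℤ} (a : ℤ)
         (f-double : ∀ t → f (2 ℕ.* t) ≡ a * g t)
         (f-odd : ∀ t → f (suc (2 ℕ.* t)) ≡ 0ℤ) where

  convSuc-double : ∀ k t → convSuc k f (2 ℕ.* t) ≡ a ^ suc k * convSuc k g t
  convSuc-odd    : ∀ k t → convSuc k f (suc (2 ℕ.* t)) ≡ 0ℤ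

  convSuc-double zero t = trans (f-double t) (cong (_* g t) (sym (ℤ.*-identityʳ a)))
  convSuc-double (suc k) t = begin
    sumℤ (map F (upTo (suc (2 ℕ.* t))))
      ≡⟨ sumℤ-map-upTo F (suc (2 ℕ.* t)) ⟩
    ∑< (suc (2 ℕ.* t)) F
      ≡⟨ ∑<-suc-even-odd t F ⟩
    ∑[ i < suc t ] F (2 ℕ.* i) + ∑[ i < t ] F (suc (2 ℕ.* i))
      ≡⟨ cong₂ _+_ (∑<-cong (suc t) λ {i} _ → F-even i) (∑<-zero t λ {i} _ → F-odd i) ⟩
    ∑[ i < suc t ] (a ^ suc (suc k) * G i) + 0ℤ
      ≡⟨ ℤ.+-identityʳ _ ⟩
    ∑[ i < suc t ] (a ^ suc (suc k) * G i)
      ≡⟨ *-distribˡ-∑< (suc t) (a ^ suc (suc k)) G ⟩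
    a ^ suc (suc k) * ∑< (suc t) G
      ≡⟨ cong (a ^ suc (suc k) *_) (sumℤ-map-upTo G (suc t)) ⟨
    a ^ suc (suc k) * convSuc (suc k) g t
      ∎
    where
    F G : ℕ → ℤ
    F b = f b * convSuc k f (2 ℕ.* t ∸ b)
    G b = g b * convSuc k g (t ∸ b)
    regroup : ∀ a x y z → (a * x) * ((a * y) * z) ≡ (a * (a * y)) * (x * z)
    regroup = solve-∀
    F-even : ∀ i → F (2 ℕ.* i) ≡ a ^ suc (suc k) * G i
    F-even i = begin
      f (2 ℕ.* i) * convSuc k f (2 ℕ.* t ∸ 2 ℕ.* i)
        ≡⟨ cong (λ m → f (2 ℕ.* i) * convSuc k f m) (2*m∸2*n≡2*[m∸n] t i) ⟩
      f (2 ℕ.* i) * convSuc k f (2 ℕ.* (t ∸ i))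
        ≡⟨ cong₂ _*_ (f-double i) (convSuc-double k (t ∸ i)) ⟩
      (a * g i) * ((a * a ^ k) * convSuc k g (t ∸ i))
        ≡⟨ regroup a (g i) (a ^ k) _ ⟩
      a ^ suc (suc k) * G i
        ∎
    F-odd : ∀ i → F (suc (2 ℕ.* i)) ≡ 0ℤ
    F-odd i = cong (_* convSuc k f (2 ℕ.* t ∸ suc (2 ℕ.* i))) (f-odd i)

  convSuc-odd zero t = f-odd t
  convSuc-odd (suc k) t = begin
    sumℤ (map F (upTo (suc (suc (2 ℕ.* t)))))
      ≡⟨ sumℤ-map-upTo F (suc (suc (2 ℕ.* t))) ⟩
    ∑< (suc (suc (2 ℕ.* t))) F
      ≡⟨ cong (λ m → ∑< m F) (ℕ.*-suc 2 t) ⟨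
    ∑< (2 ℕ.* suc t) F
      ≡⟨ ∑<-even-odd (suc t) F ⟩
    ∑[ i < suc t ] F (2 ℕ.* i) + ∑[ i < suc t ] F (suc (2 ℕ.* i))
      ≡⟨ cong₂ _+_ (∑<-zero (suc t) F-even) (∑<-zero (suc t) λ {i} _ → F-odd i) ⟩
    0ℤ
      ∎
    where
    F : ℕ → ℤ
    F b = f b * convSuc k f (suc (2 ℕ.* t) ∸ b)
    F-even : ∀ {i} → i ℕ.< suc t → F (2 ℕ.* i) ≡ 0ℤ
    F-even {i} (s≤s i≤t) = begin
      f (2 ℕ.* i) * convSuc k f (suc (2 ℕ.* t) ∸ 2 ℕ.* i)
        ≡⟨ cong (λ m → f (2 ℕ.* i) * convSuc k f m) (1+2*m∸2*n≡1+2*[m∸n] i≤t) ⟩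
      f (2 ℕ.* i) * convSuc k f (suc (2 ℕ.* (t ∸ i)))
        ≡⟨ cong (f (2 ℕ.* i) *_) (convSuc-odd k (t ∸ i)) ⟩
      f (2 ℕ.* i) * 0ℤ
        ≡⟨ ℤ.*-zeroʳ (f (2 ℕ.* i)) ⟩
      0ℤ
        ∎
    F-odd : ∀ i → F (suc (2 ℕ.* i)) ≡ 0ℤ
    F-odd i = cong (_* convSuc k f (suc (2 ℕ.* t) ∸ suc (2 ℕ.* i))) (f-odd i)

  conv-double : ∀ k x → conv k f (+ 2 * x) ≡ a ^ k * conv k g x
  conv-double zero    x        = sym (ℤ.*-zeroʳ 1ℤ)
  conv-double (suc k) (+ t)    = trans (cong (conv (suc k) f) (sym (ℤ.pos-* 2 t))) (convSuc-double k t)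
  conv-double (suc k) -[1+ t ] = sym (ℤ.*-zeroʳ (a ^ suc k))

  conv-odd : ∀ k x → conv k f (+ 2 * x + 1ℤ) ≡ 0ℤ
  conv-odd zero    x        = refl
  conv-odd (suc k) (+ t)    = trans (cong (conv (suc k) f) 2*t+1≡1+2*t) (convSuc-odd k t)
    where
    2*t+1≡1+2*t : + 2 * + t + 1ℤ ≡ + suc (2 ℕ.* t)
    2*t+1≡1+2*t = begin
      + 2 * + t + 1ℤ     ≡⟨ cong (_+ 1ℤ) (sym (ℤ.pos-* 2 t)) ⟩
      + (2 ℕ.* t) + 1ℤ   ≡⟨ ℤ.+-comm (+ (2 ℕ.* t)) 1ℤ ⟩
      + suc (2 ℕ.* t)    ∎
  -- After rewriting t + suc (t + 0) to suc (t + (t + 0)) the argument normalises to -[1+ t + (t + 0) ].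
  conv-odd (suc k) -[1+ t ] = cong (λ m → conv (suc k) f (-[1+ m ] + 1ℤ)) (ℕ.+-suc t (t ℕ.+ 0))

^-preserves-inverse-mod : ∀ q {a b w₀} → a * b ≡ 1ℤ + q * w₀ →
                          ∀ k → ∃ λ w → a ^ k * b ^ k ≡ 1ℤ + q * w
^-preserves-inverse-mod q _ zero = 0ℤ , cong (_+_ 1ℤ) (sym (ℤ.*-zeroʳ q))
^-preserves-inverse-mod q {a} {b} {w₀} ab≡1 (suc k) =
  let w , e = ^-preserves-inverse-mod q ab≡1 k in
  w₀ + w + q * w₀ * w , (begin
    (a * a ^ k) * (b * b ^ k)   ≡⟨ interchange a (a ^ k) b (b ^ k) ⟩
    (a * b) * (a ^ k * b ^ k)   ≡⟨ cong₂ _*_ ab≡1 e ⟩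
    (1ℤ + q * w₀) * (1ℤ + q * w) ≡⟨ expand q w₀ w ⟩
    1ℤ + q * (w₀ + w + q * w₀ * w) ∎)
  where
  interchange : ∀ a x b y → (a * x) * (b * y) ≡ (a * b) * (x * y)
  interchange = solve-∀
  expand : ∀ q u v → (1ℤ + q * u) * (1ℤ + q * v) ≡ 1ℤ + q * (u + v + q * u * v)
  expand = solve-∀

∣m+k*n⇔∣m : ∀ {k m} n → k ∣ m + k * n ⇔ k ∣ m
∣m+k*n⇔∣m {k} {m} n = mk⇔
  (λ k∣m+kn → ∣⇒∣ᵤ {k} {m} (∣m+n∣n⇒∣m (∣ᵤ⇒∣ {k} {m + k * n} k∣m+kn) k∣kn))
  (λ k∣m → ∣⇒∣ᵤ {k} {m + k * n} (∣m∣n⇒∣m+n (∣ᵤ⇒∣ {k} {m} k∣m) k∣kn))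
  where
  k∣kn : k ∣ₛ k * n
  k∣kn = ∣m⇒∣m*n n ∣ₛ-refl

even-or-odd : ∀ n → (∃ λ m → n ≡ + 2 * m) ⊎ (∃ λ m → n ≡ + 2 * m + 1ℤ)
even-or-odd n = by-remainder (n ℤ/.% + 2) (ℤ/.n%d<d n (+ 2)) (ℤ/.a≡a%n+[a/n]*n n (+ 2))
  where
  by-remainder : ∀ ρ → ρ ℕ.< 2 → n ≡ + ρ + n ℤ/./ + 2 * + 2 →
                 (∃ λ m → n ≡ + 2 * m) ⊎ (∃ λ m → n ≡ + 2 * m + 1ℤ)
  by-remainder 0 _ e = inj₁ (n ℤ/./ + 2 , trans e (0+m*2≡2*m (n ℤ/./ + 2)))
    where
    0+m*2≡2*m : ∀ m → 0ℤ + m * + 2 ≡ + 2 * m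
    0+m*2≡2*m = solve-∀
  by-remainder 1 _ e = inj₂ (n ℤ/./ + 2 , trans e (1+m*2≡2*m+1 (n ℤ/./ + 2)))
    where
    1+m*2≡2*m+1 : ∀ m → 1ℤ + m * + 2 ≡ + 2 * m + 1ℤ
    1+m*2≡2*m+1 = solve-∀
  by-remainder (suc (suc _)) (s≤s (s≤s ())) _

2∣1+n-of-odd : ∀ {n} → ¬ 2 ℕ∣ n → 2 ℕ∣ n ℕ.+ 1
2∣1+n-of-odd {zero}        2∤0 = contradiction (2 ℕ∣.∣0) 2∤0
2∣1+n-of-odd {suc zero}    _   = ℕ∣.∣-refl
2∣1+n-of-odd {suc (suc n)} 2∤n+2 =
  ℕ∣.∣m∣n⇒∣m+n (ℕ∣.∣-refl {2}) (2∣1+n-of-odd λ 2∣n → 2∤n+2 (ℕ∣.∣m∣n⇒∣m+n (ℕ∣.∣-refl {2}) 2∣n))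

module _ (N : ℕ) (c : ℕ → ℤ) (q h : ℤ) (h*2≡q+1 : h * + 2 ≡ q + 1ℤ) where

  σSum σevenSum : ℤ → ℤ
  σSum     x = sumFrom1 N (λ k → c k * conv k σℕ x)
  σevenSum y = sumFrom1 N (λ k → h ^ k * c k * conv k σevenℕ y)

  private
    conv-σevenℕ-double : ∀ k x → conv k σevenℕ (+ 2 * x) ≡ (+ 2) ^ k * conv k σℕ x
    conv-σevenℕ-double = conv-double (+ 2) σevenℕ-double (σevenℕ-odd ∘ 2∤1+2*n)

    conv-σevenℕ-odd : ∀ k x → conv k σevenℕ (+ 2 * x + 1ℤ) ≡ 0ℤ
    conv-σevenℕ-odd = conv-odd (+ 2) σevenℕ-double (σevenℕ-odd ∘ 2∤1+2*n)

  σevenSum-double : ∀ x → ∃ λ B → σevenSum (+ 2 * x) ≡ σSum x + q * B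
  σevenSum-double x = ∑< N (B ∘ suc) , (begin
    σevenSum (+ 2 * x)
      ≡⟨ sumℤ-map-upTo _ N ⟩
    ∑[ i < N ] (h ^ suc i * c (suc i) * conv (suc i) σevenℕ (+ 2 * x))
      ≡⟨ ∑<-cong N (λ {i} _ → term (suc i)) ⟩
    ∑[ i < N ] (c (suc i) * conv (suc i) σℕ x + q * B (suc i))
      ≡⟨ ∑<-distrib-+ N _ _ ⟩
    ∑[ i < N ] (c (suc i) * conv (suc i) σℕ x) + ∑[ i < N ] (q * B (suc i))
      ≡⟨ cong₂ _+_ (sym (sumℤ-map-upTo _ N)) (*-distribˡ-∑< N q (B ∘ suc)) ⟩
    σSum x + q * ∑< N (B ∘ suc)
      ∎)
    where
    m+1≡1+m*1 : ∀ m → m + 1ℤ ≡ 1ℤ + m * 1ℤ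
    m+1≡1+m*1 = solve-∀
    2⁻¹-powers : ∀ k → ∃ λ w → h ^ k * (+ 2) ^ k ≡ 1ℤ + q * w
    2⁻¹-powers = ^-preserves-inverse-mod q (trans h*2≡q+1 (m+1≡1+m*1 q))
    B : ℕ → ℤ
    B k = proj₁ (2⁻¹-powers k) * (c k * conv k σℕ x)
    regroup : ∀ u v c C → u * c * (v * C) ≡ (u * v) * (c * C)
    regroup = solve-∀
    expand : ∀ q w X → (1ℤ + q * w) * X ≡ X + q * (w * X)
    expand = solve-∀
    term : ∀ k → h ^ k * c k * conv k σevenℕ (+ 2 * x) ≡ c k * conv k σℕ x + q * B k
    term k = begin
      h ^ k * c k * conv k σevenℕ (+ 2 * x)
        ≡⟨ cong (h ^ k * c k *_) (conv-σevenℕ-double k x) ⟩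
      h ^ k * c k * ((+ 2) ^ k * conv k σℕ x)
        ≡⟨ regroup (h ^ k) ((+ 2) ^ k) (c k) _ ⟩
      (h ^ k * (+ 2) ^ k) * (c k * conv k σℕ x)
        ≡⟨ cong (_* (c k * conv k σℕ x)) (proj₂ (2⁻¹-powers k)) ⟩
      (1ℤ + q * proj₁ (2⁻¹-powers k)) * (c k * conv k σℕ x)
        ≡⟨ expand q _ _ ⟩
      c k * conv k σℕ x + q * B k
        ∎

  σevenSum-odd : ∀ x → σevenSum (+ 2 * x + 1ℤ) ≡ 0ℤ
  σevenSum-odd x = trans (sumℤ-map-upTo _ N) (∑<-zero N λ {i} _ → term-vanishes (suc i))
    where
    term-vanishes : ∀ k → h ^ k * c k * conv k σevenℕ (+ 2 * x + 1ℤ) ≡ 0ℤ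
    term-vanishes k = trans (cong (h ^ k * c k *_) (conv-σevenℕ-odd k x)) (ℤ.*-zeroʳ (h ^ k * c k))

  ∣σevenSum-double⇔∣σSum : ∀ x → q ∣ σevenSum (+ 2 * x) ⇔ q ∣ σSum x
  ∣σevenSum-double⇔∣σSum x =
    let B , e = σevenSum-double x in subst (λ y → q ∣ y ⇔ q ∣ σSum x) (sym e) (∣m+k*n⇔∣m {q} {σSum x} B)

  σSum⇔σevenSum : ∀ r → (∀ n → q ∣ σSum (q * n + r)) ⇔ (∀ n → q ∣ σevenSum (q * n + + 2 * r))
  σSum⇔σevenSum r = mk⇔ to from
    where
    even-index : ∀ m → q * (+ 2 * m) + + 2 * r ≡ + 2 * (q * m + r)
    even-index m = distrib q m r
      where
      distrib : ∀ q m r → q * (+ 2 * m) + + 2 * r ≡ + 2 * (q * m + r)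
      distrib = solve-∀

    odd-index : ∀ m → q * (+ 2 * m + 1ℤ) + + 2 * r ≡ + 2 * (q * m + r + h - 1ℤ) + 1ℤ
    odd-index m = sym (begin
      + 2 * (q * m + r + h - 1ℤ) + 1ℤ        ≡⟨ expand q m r h ⟩
      q * (+ 2 * m) + + 2 * r + h * + 2 - 1ℤ ≡⟨ cong (λ y → q * (+ 2 * m) + + 2 * r + y - 1ℤ) h*2≡q+1 ⟩
      q * (+ 2 * m) + + 2 * r + (q + 1ℤ) - 1ℤ ≡⟨ collect q m r ⟩
      q * (+ 2 * m + 1ℤ) + + 2 * r           ∎)
      where
      expand : ∀ q m r h → + 2 * (q * m + r + h - 1ℤ) + 1ℤ ≡ q * (+ 2 * m) + + 2 * r + h * + 2 - 1ℤ
      expand = solve-∀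
      collect : ∀ q m r → q * (+ 2 * m) + + 2 * r + (q + 1ℤ) - 1ℤ ≡ q * (+ 2 * m + 1ℤ) + + 2 * r
      collect = solve-∀

    to : (∀ n → q ∣ σSum (q * n + r)) → ∀ n → q ∣ σevenSum (q * n + + 2 * r)
    to q∣σSum n with even-or-odd n
    ... | inj₁ (m , refl) = subst (λ y → q ∣ σevenSum y) (sym (even-index m))
                              (Equivalence.from (∣σevenSum-double⇔∣σSum (q * m + r)) (q∣σSum m))
    ... | inj₂ (m , refl) = subst (λ y → q ∣ σevenSum y) (sym (odd-index m))
                              (subst (q ∣_) (sym (σevenSum-odd (q * m + r + h - 1ℤ))) (ℤ.∣ q ∣ ℕ∣.∣0))

    from : (∀ n → q ∣ σevenSum (q * n + + 2 * r)) → ∀ n → q ∣ σSum (q * n + r)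
    from q∣σevenSum n = Equivalence.to (∣σevenSum-double⇔∣σSum (q * n + r))
                          (subst (λ y → q ∣ σevenSum y) (even-index n) (q∣σevenSum (+ 2 * n)))

proposition5p1 : (q : ℕ) → Prime q → ¬ (2 ℕ∣ q) → (r : ℤ) → (c : ℕ → ℤ) →
    ((∀ (n : ℤ) → + q ∣ sumFrom1 (q ∸ 1) (λ k → c k * conv k σℕ (+ q * n + r)))
    ⇔
    (∀ (n : ℤ) → + q ∣ sumFrom1 (q ∸ 1) (λ k → ((+ ((q ℕ.+ 1) / 2)) ^ k) * c k * conv k σevenℕ (+ q * n + + 2 * r))))
proposition5p1 q _ 2∤q r c = σSum⇔σevenSum (q ∸ 1) c (+ q) (+ ((q ℕ.+ 1) / 2)) h*2≡q+1 r
  where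
  h*2≡q+1 : + ((q ℕ.+ 1) / 2) * + 2 ≡ + q + 1ℤ
  h*2≡q+1 = begin
    + ((q ℕ.+ 1) / 2) * + 2   ≡⟨ ℤ.pos-* ((q ℕ.+ 1) / 2) 2 ⟨
    + ((q ℕ.+ 1) / 2 ℕ.* 2)   ≡⟨ cong +_ (ℕ/.m/n*n≡m {q ℕ.+ 1} {2} (2∣1+n-of-odd 2∤q)) ⟩
    + (q ℕ.+ 1)               ≡⟨ ℤ.pos-+ q 1 ⟩
    + q + 1ℤ                  ∎
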